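{- Let $C$ be a clone on $\{0,1\}$. The $(C,I^*)$-clonoids are precisely the $(C,I_c)$-clonoids $K$ satisfying $K=\overline K$.
   Context: A Boolean function is $f\colon\{0,1\}^n\to\{0,1\}$, $n\ge1$. For sets $F,G$ of Boolean functions, $FG:=\{f(g_1,\dots,g_n): f\in F\ n\text{ -ary},\ g_i\in G\text{ all } m\text{ -ary}\}$. A clone is a set of Boolean functions containing all projections and closed under composition; for clones $C_1,C_2$ a $(C_1,C_2)$-clonoid is a set $K$ of Boolean functions with $KC_1\subseteq K$, $C_2K\subseteq K$. $\overline K=\{\neg\circ f: f\in K\}$. $I_c$ is the clone of projections and $I^*=I_c\cup\overline{I_c}$ (projections and negated projections). -}

module Defs where

open import Data.Nat using (ℕ; suc)
open import Data.Fin using (Fin)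
open import Data.Bool using (Bool; not)
open import Data.Product using (Σ; ∃; ∃-syntax; _×_)
open import Data.Sum using (_⊎_)
open import Relation.Binary.PropositionalEquality using (_≗_)
open import Level using (0ℓ) renaming (suc to lsuc)

-- A Boolean function of arity (suc k) (arities are ≥ 1).
BF : ℕ → Set
BF k = (Fin (suc k) → Bool) → Bool

FSet : Set₁
FSet = (k : ℕ) → BF k → Set

Extensional : FSet → Set
Extensional K = ∀ k (f g : BF k) → f ≗ g → K k f → K k g

_⊆_ : FSet → FSet → Set
A ⊆ B = ∀ k (f : BF k) → A k f → B k f

_≐_ : FSet → FSet → Set
A ≐ B = (A ⊆ B) × (B ⊆ A)

compose : ∀ {n m} → BF n → (Fin (suc n) → BF m) → BF m
compose f g x = f (λ i → g i x)

_·_ : FSet → FSet → FSet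
(F · G) m h = Σ ℕ λ n → Σ (BF n) λ f → Σ (Fin (suc n) → BF m) λ g →
  F n f × (∀ i → G m (g i)) × (h ≗ compose f g)

proj : ∀ {k} → Fin (suc k) → BF k
proj i x = x i

IsClone : FSet → Set
IsClone C = Extensional C × (∀ k (i : Fin (suc k)) → C k (proj i)) × ((C · C) ⊆ C)

IsClonoid : FSet → FSet → FSet → Set
IsClonoid C₁ C₂ K = ((K · C₁) ⊆ K) × ((C₂ · K) ⊆ K)

bar : FSet → FSet
bar K k h = Σ (BF k) λ f → K k f × (h ≗ (λ x → not (f x)))

Ic : FSet
Ic k h = ∃[ i ] (h ≗ proj i)

Istar : FSet
Istar k h = Ic k h ⊎ bar Ic k h

{-# OPTIONS --safe #-}
-- Composing K with a projection gives K back (up to extensionality), and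
-- composing it with a negated projection gives exactly K̄.  Hence
-- I* K ⊆ K amounts to I_c K ⊆ K together with K̄ ⊆ K, and K̄ ⊆ K already
-- forces K = K̄ since negation is an involution.
module Submission where

open import Defs
open import Data.Product using (_×_; _,_)
open import Data.Sum using (_⊎_; inj₁; inj₂; [_,_])
open import Data.Fin using (zero)
open import Data.Bool using (not)
open import Data.Bool.Properties using (not-involutive)
open import Function.Base using (_∘_)
open import Function.Bundles using (_⇔_; mk⇔)
open import Relation.Binary.PropositionalEquality using (refl; sym; trans)

private variable
  A B F G K : FSet

_∪_ : FSet → FSet → FSet
(A ∪ B) k h = A k h ⊎ B k h

⊆-trans : A ⊆ B → B ⊆ G → A ⊆ G
⊆-trans A⊆B B⊆G k h = B⊆G k h ∘ A⊆B k h

·-monoˡ : A ⊆ B → (A · G) ⊆ (B · G)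
·-monoˡ A⊆B m h (n , f , g , f∈A , g∈G , h≗fg) = n , f , g , A⊆B n f f∈A , g∈G , h≗fg

·-distribʳ-∪ : ((A ∪ B) · G) ⊆ ((A · G) ∪ (B · G))
·-distribʳ-∪ m h (n , f , g , inj₁ f∈A , g∈G , h≗fg) = inj₁ (n , f , g , f∈A , g∈G , h≗fg)
·-distribʳ-∪ m h (n , f , g , inj₂ f∈B , g∈G , h≗fg) = inj₂ (n , f , g , f∈B , g∈G , h≗fg)

Ic·⊆ : Extensional K → (Ic · K) ⊆ K
Ic·⊆ ext m h (n , f , g , (i , f≗πᵢ) , g∈K , h≗fg) =
  ext m (g i) h (λ x → sym (trans (h≗fg x) (f≗πᵢ (λ j → g j x)))) (g∈K i)

bar-mono : A ⊆ B → bar A ⊆ bar B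
bar-mono A⊆B k h (f , f∈A , h≗¬f) = f , A⊆B k f f∈A , h≗¬f

⊆-bar-bar : K ⊆ bar (bar K)
⊆-bar-bar k f f∈K = (λ x → not (f x)) , (f , f∈K , λ _ → refl) , λ x → sym (not-involutive (f x))

bar-closed⇒≐bar : bar K ⊆ K → K ≐ bar K
bar-closed⇒≐bar K̄⊆K = ⊆-trans ⊆-bar-bar (bar-mono K̄⊆K) , K̄⊆K

bar-·ˡ : (bar F · G) ⊆ bar (F · G)
bar-·ˡ m h (n , f , g , (f′ , f′∈F , f≗¬f′) , g∈G , h≗fg) =
  compose f′ g , (n , f′ , g , f′∈F , g∈G , λ _ → refl) ,
  λ x → trans (h≗fg x) (f≗¬f′ (λ j → g j x))

bar⊆bar-Ic· : bar G ⊆ (bar Ic · G)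
bar⊆bar-Ic· m h (f , f∈G , h≗¬f) =
  0 , (λ y → not (y zero)) , (λ _ → f) ,
  (proj zero , (zero , λ _ → refl) , λ _ → refl) , (λ _ → f∈G) , h≗¬f

Ic⊆Istar : Ic ⊆ Istar
Ic⊆Istar _ _ = inj₁

bar-Ic⊆Istar : bar Ic ⊆ Istar
bar-Ic⊆Istar _ _ = inj₂

lemma3p3 : (C : FSet) → IsClone C → (K : FSet) → Extensional K →
    (IsClonoid C Istar K ⇔ (IsClonoid C Ic K × (K ≐ bar K)))
lemma3p3 C _ K ext = mk⇔ to from
  where
  to : IsClonoid C Istar K → IsClonoid C Ic K × (K ≐ bar K)
  to (KC⊆K , I*K⊆K) = (KC⊆K , IcK⊆K) , bar-closed⇒≐bar K̄⊆K
    where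
    IcK⊆K : (Ic · K) ⊆ K
    IcK⊆K = ⊆-trans (·-monoˡ {G = K} Ic⊆Istar) I*K⊆K

    K̄⊆K : bar K ⊆ K
    K̄⊆K = ⊆-trans (bar⊆bar-Ic· {G = K}) (⊆-trans (·-monoˡ {G = K} bar-Ic⊆Istar) I*K⊆K)

  from : IsClonoid C Ic K × (K ≐ bar K) → IsClonoid C Istar K
  from ((KC⊆K , _) , (_ , K̄⊆K)) = KC⊆K , I*K⊆K
    where
    I̅cK⊆K : (bar Ic · K) ⊆ K
    I̅cK⊆K = ⊆-trans (bar-·ˡ {G = K}) (⊆-trans (bar-mono (Ic·⊆ ext)) K̄⊆K)

    I*K⊆K : (Istar · K) ⊆ K
    I*K⊆K = ⊆-trans (·-distribʳ-∪ {G = K}) (λ m h → [ Ic·⊆ ext m h , I̅cK⊆K m h ])
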